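{- Let $f:\{0,1\}^n\to\{0,1\}^n$ be a Boolean network such that the interaction graph $G(f)$ has no negative loop. Then there exists a monotone Boolean network $f':\{0,1\}^{2n}\to\{0,1\}^{2n}$ such that: (i) for every $x\in\{0,1\}^n$, $x$ is a fixed point of $f$ if and only if $(x,\overline{x})$ is a fixed point of $f'$; and (ii) for all $x,y\in\{0,1\}^n$ and every integer $\ell\geq 0$, $\Gamma(f)$ has a path from $x$ to $y$ of length $\ell$ if and only if $\Gamma(f')$ has a path from $(x,\overline{x})$ to $(y,\overline{y})$ of length $2\ell$.
   Context: A Boolean network is a map $f:\{0,1\}^n\to\{0,1\}^n$, $x\mapsto (f_1(x),\dots,f_n(x))$; it is monotone if $x\leq y$ (componentwise) implies $f(x)\leq f(y)$. $G(f)$ has a negative loop on vertex $i$ if there exists $x\in\{0,1\}^n$ with $f_i(x_1,\dots,x_{i-1},1,x_{i+1},\dots,x_n)<f_i(x_1,\dots,x_{i-1},0,x_{i+1},\dots,x_n)$; "no negative loop" means this happens for no $i\in[n]$. The asynchronous graph $\Gamma(f)$ has vertex set $\{0,1\}^n$ and an arc from $x$ to $y$ whenever there is $i$ with $f_i(x)=y_i\neq x_i$ and $y_j=x_j$ for all $j\neq i$; the length of a path is its number of arcs. For $x\in\{0,1\}^n$, $\overline{x}$ is obtained by complementing every component, and for $x,y\in\{0,1\}^n$, $(x,y)\in\{0,1\}^{2n}$ denotes the concatenation. -}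

module Defs where

open import Data.Nat using (ℕ; zero; suc; _+_; _*_)
open import Data.Bool using (Bool; true; false; not) renaming (_≤_ to _≤ᵇ_)
open import Data.Fin using (Fin)
open import Data.Vec using (Vec; lookup; _[_]≔_; map; _++_)
open import Data.Vec.Relation.Binary.Pointwise.Inductive using (Pointwise)
open import Data.Product using (Σ; ∃; _×_; _,_)
open import Relation.Binary.PropositionalEquality using (_≡_; _≢_)
open import Relation.Nullary using (¬_)

Config : ℕ → Set
Config n = Vec Bool n

BN : ℕ → Set
BN n = Config n → Config n

_≤ᶜ_ : ∀ {n} → Config n → Config n → Set
x ≤ᶜ y = Pointwise _≤ᵇ_ x y

Monotone : ∀ {n} → BN n → Set
Monotone f = ∀ x y → x ≤ᶜ y → f x ≤ᶜ f y

NegativeLoopAt : ∀ {n} → BN n → Fin n → Set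
NegativeLoopAt f i = ∃ λ x →
  (lookup (f (x [ i ]≔ true)) i ≡ false) × (lookup (f (x [ i ]≔ false)) i ≡ true)

NoNegativeLoop : ∀ {n} → BN n → Set
NoNegativeLoop {n} f = (i : Fin n) → ¬ NegativeLoopAt f i

FixedPoint : ∀ {n} → BN n → Config n → Set
FixedPoint f x = f x ≡ x

Arc : ∀ {n} → BN n → Config n → Config n → Set
Arc f x y = ∃ λ i → (lookup (f x) i ≢ lookup x i) × (y ≡ x [ i ]≔ lookup (f x) i)

data Path {n} (f : BN n) : Config n → Config n → ℕ → Set where
  here  : ∀ {x} → Path f x x zero
  step  : ∀ {x y z ℓ} → Arc f x y → Path f y z ℓ → Path f x z (suc ℓ)

comp : ∀ {n} → Config n → Config n
comp = map not

pairC : ∀ {n} → Config n → Config (n + n)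
pairC x = x ++ comp x

-- A state of {0,1}^{2n} is read as a pair of rails (l , h), stored as (h , l̄), which stands for
-- the interval [l , h] of the cube; the dual-rail encoding (x , x̄) of x is the point [x , x].
-- The monotone network f′ maps an interval [l , h] with at most two points to
-- [f l ∧ f h , f l ∨ f h], an inverted interval to 0…0 and an interval with more than two points
-- to 1…1. If [l , h] ⊆ [l′ , h′] and the latter has at most two points, then l and h are among its
-- ends, so f′ is monotone for inclusion of intervals, which is the order of {0,1}^{2n} read on rails.
-- An arc x → x′ of Γ(f) flipping coordinate i is simulated by widening [x , x] to the edge
-- {x , x′} and collapsing it onto x′; the collapse is enabled because, without a negative loop,
-- f_i takes the same value at both ends of that edge. Conversely, the only way out of a point
-- that does not fall into the absorbing inverted or large intervals is through such an edge, and
-- collapsing the edge back onto x would contradict the first step.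

module Submission where

open import Defs
open import Data.Bool.Base using (Bool; true; false; not; _∧_; _∨_; _<_; f<t; f≤t; b≤b)
  renaming (_≤_ to _≤ᵇ_)
open import Data.Bool.Properties
  using (_<?_; ≤-reflexive; ≤-antisym; ≤-minimum; ≤-maximum; <-irrefl; <-transˡ; <-transʳ;
         ∧-idem; ∨-idem; ∧-conicalˡ; ∧-conicalʳ; ∨-conicalˡ; ∨-conicalʳ;
         not-involutive; not-injective; ¬-not)
  renaming (_≤?_ to _≤ᵇ?_; ≤-refl to ≤ᵇ-refl; ≤-trans to ≤ᵇ-trans)
open import Data.Empty using (⊥-elim)
open import Data.Fin.Base using (Fin; _↑ˡ_; _↑ʳ_; splitAt; join)
open import Data.Fin.Properties using (all?; any?; join-splitAt) renaming (_≟_ to _≟ᶠ_)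
open import Data.Nat using (ℕ; zero; suc; _+_; _*_)
open import Data.Nat.Properties using (*-suc)
open import Data.Product using (Σ; ∃; _×_; _,_; proj₁; proj₂)
open import Data.Sum.Base as Sum using (_⊎_; inj₁; inj₂)
open import Data.Vec.Base using (Vec; []; _∷_; lookup; _[_]≔_; _++_; replicate; zipWith; take; drop)
open import Data.Vec.Properties
  using (lookup-++ˡ; lookup-++ʳ; lookup-map; lookup-zipWith; lookup∘update; lookup∘update′;
         []≔-lookup; []≔-idempotent; []≔-++-↑ˡ; []≔-++-↑ʳ; map-[]≔; ++-injective; take++drop≡id;
         zipWith-idem)
open import Data.Vec.Relation.Binary.Pointwise.Inductive as Pointwise
  using (Pointwise; []; _∷_; Pointwise-≡⇒≡; ++⁺; ++⁻)
open import Data.Vec.Relation.Binary.Pointwise.Extensional using (ext; extensional⇒inductive)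
open import Function.Base using (_∘_; id)
open import Function.Bundles using (_⇔_; mk⇔)
open import Relation.Binary.PropositionalEquality
open import Relation.Nullary using (¬_; Dec; yes; no)
open import Relation.Nullary.Decidable using (_×-dec_; _→-dec_)

private
  variable
    m n ℓ : ℕ
    a b c v : Bool
    i k : Fin n
    l h x z : Config n

≤⇒≡⊎< : a ≤ᵇ b → a ≡ b ⊎ a < b
≤⇒≡⊎< b≤b = inj₁ refl
≤⇒≡⊎< f≤t = inj₂ f<t

≤∧≢⇒false-true : a ≤ᵇ b → a ≢ b → a ≡ false × b ≡ true
≤∧≢⇒false-true b≤b a≢b = ⊥-elim (a≢b refl)
≤∧≢⇒false-true f≤t _   = refl , refl

<-covers : a < b → ∀ c → c ≡ a ⊎ c ≡ b
<-covers f<t false = inj₁ refl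
<-covers f<t true  = inj₂ refl

true-≤ : true ≤ᵇ b → b ≡ true
true-≤ b≤b = refl

≤-false : a ≤ᵇ false → a ≡ false
≤-false b≤b = refl

monotone-moves⇒constant : (g : Bool → Bool) → g false ≤ᵇ g true → g a ≢ a → ∀ c → g c ≡ g a
monotone-moves⇒constant {false} g _      _     false = refl
monotone-moves⇒constant {true}  g _      _     true  = refl
monotone-moves⇒constant {false} g g-mono moves true  =
  trans (true-≤ (subst (_≤ᵇ g true) (¬-not moves) g-mono)) (sym (¬-not moves))
monotone-moves⇒constant {true}  g g-mono moves false =
  trans (≤-false (subst (g false ≤ᵇ_) (¬-not moves) g-mono)) (sym (¬-not moves))

not-antitone : a ≤ᵇ b → not b ≤ᵇ not a
not-antitone b≤b = b≤b
not-antitone f≤t = f≤t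

∧-greatest : c ≤ᵇ a → c ≤ᵇ b → c ≤ᵇ a ∧ b
∧-greatest {a = false} c≤a _ = c≤a
∧-greatest {a = true}  _ c≤b = c≤b

∨-least : a ≤ᵇ c → b ≤ᵇ c → a ∨ b ≤ᵇ c
∨-least {a = false} _ b≤c = b≤c
∨-least {a = true}  a≤c _ = a≤c

∧-≤-either : c ≡ a ⊎ c ≡ b → a ∧ b ≤ᵇ c
∧-≤-either {a = false}     (inj₁ refl) = b≤b
∧-≤-either {a = true}  {b} (inj₁ refl) = ≤-maximum b
∧-≤-either {a = false} {b} (inj₂ refl) = ≤-minimum b
∧-≤-either {a = true}      (inj₂ refl) = b≤b

∨-≥-either : c ≡ a ⊎ c ≡ b → c ≤ᵇ a ∨ b
∨-≥-either {a = false} {b} (inj₁ refl) = ≤-minimum b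
∨-≥-either {a = true}      (inj₁ refl) = b≤b
∨-≥-either {a = false}     (inj₂ refl) = b≤b
∨-≥-either {a = true}  {b} (inj₂ refl) = ≤-maximum b

pointwise : {R : Bool → Bool → Set} → (∀ i → R (lookup x i) (lookup z i)) → Pointwise R x z
pointwise = extensional⇒inductive ∘ ext

lookup-extensionality : (∀ i → lookup x i ≡ lookup z i) → x ≡ z
lookup-extensionality = Pointwise-≡⇒≡ ∘ pointwise

≤ᶜ-refl : x ≤ᶜ x
≤ᶜ-refl = Pointwise.refl ≤ᵇ-refl

≤ᶜ-trans : x ≤ᶜ z → z ≤ᶜ h → x ≤ᶜ h
≤ᶜ-trans = Pointwise.trans ≤ᵇ-trans

≤ᶜ-all-true : (x : Config n) → x ≤ᶜ replicate n true
≤ᶜ-all-true []      = []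
≤ᶜ-all-true (b ∷ x) = ≤-maximum b ∷ ≤ᶜ-all-true x

all-false-≤ᶜ : (x : Config n) → replicate n false ≤ᶜ x
all-false-≤ᶜ []      = []
all-false-≤ᶜ (b ∷ x) = ≤-minimum b ∷ all-false-≤ᶜ x

[]≔-≤ᶜ : v ≤ᵇ lookup x i → (x [ i ]≔ v) ≤ᶜ x
[]≔-≤ᶜ {v = v} {x = x} {i = i} v≤xᵢ = pointwise at
  where
  at : ∀ k → lookup (x [ i ]≔ v) k ≤ᵇ lookup x k
  at k with k ≟ᶠ i
  ... | yes refl = subst (_≤ᵇ lookup x k) (sym (lookup∘update k x v)) v≤xᵢ
  ... | no k≢i   = ≤-reflexive (lookup∘update′ k≢i x v)

≤ᶜ-[]≔ : lookup x i ≤ᵇ v → x ≤ᶜ (x [ i ]≔ v)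
≤ᶜ-[]≔ {x = x} {i = i} {v = v} xᵢ≤v = pointwise at
  where
  at : ∀ k → lookup x k ≤ᵇ lookup (x [ i ]≔ v) k
  at k with k ≟ᶠ i
  ... | yes refl = subst (lookup x k ≤ᵇ_) (sym (lookup∘update k x v)) xᵢ≤v
  ... | no k≢i   = ≤-reflexive (sym (lookup∘update′ k≢i x v))

[]≔-self : lookup x i ≡ b → x [ i ]≔ b ≡ x
[]≔-self {x = x} {i = i} xᵢ≡b = trans (cong (x [ i ]≔_) (sym xᵢ≡b)) ([]≔-lookup x i)

[]≔-agree-off : k ≢ i → lookup (x [ i ]≔ a) k ≡ lookup (x [ i ]≔ b) k
[]≔-agree-off {x = x} {a = a} {b = b} k≢i =
  trans (lookup∘update′ k≢i x a) (sym (lookup∘update′ k≢i x b))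

comp-involutive : (x : Config n) → comp (comp x) ≡ x
comp-involutive []      = refl
comp-involutive (b ∷ x) = cong₂ _∷_ (not-involutive b) (comp-involutive x)

comp-antitone : x ≤ᶜ z → comp z ≤ᶜ comp x
comp-antitone []            = []
comp-antitone (a≤b ∷ x≤z) = not-antitone a≤b ∷ comp-antitone x≤z

comp-antitone⁻ : comp x ≤ᶜ comp z → z ≤ᶜ x
comp-antitone⁻ {x = x} {z = z} c =
  subst₂ _≤ᶜ_ (comp-involutive z) (comp-involutive x) (comp-antitone c)

data Summand (m n : ℕ) : Fin (m + n) → Set where
  inl : ∀ i → Summand m n (i ↑ˡ n)
  inr : ∀ i → Summand m n (m ↑ʳ i)

summand : ∀ j → Summand m n j
summand {m} {n} j = subst (Summand m n) (join-splitAt m n j) (from-sum (splitAt m j))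
  where
  from-sum : ∀ s → Summand m n (join m n s)
  from-sum (inj₁ i) = inl i
  from-sum (inj₂ i) = inr i

Rails : ℕ → Set
Rails n = Config n × Config n

enc : Rails n → Config (n + n)
enc (l , h) = h ++ comp l

split : Config (n + n) → Rails n
split {n} s = comp (drop n s) , take n s

split-enc : (p : Rails n) → split (enc p) ≡ p
split-enc {n} (l , h) = cong₂ _,_ (trans (cong comp drop≡) (comp-involutive l)) take≡
  where
  halves = ++-injective (take n (h ++ comp l)) h (take++drop≡id n (h ++ comp l))
  take≡ = proj₁ halves
  drop≡ = proj₂ halves

enc-split : ∀ {n} (s : Config (n + n)) → enc (split {n} s) ≡ s
enc-split {n} s = trans (cong (take n s ++_) (comp-involutive (drop n s))) (take++drop≡id n s)

enc-injective : {p q : Rails n} → enc p ≡ enc q → p ≡ q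
enc-injective {p = p} {q} e = trans (sym (split-enc p)) (trans (cong split e) (split-enc q))

pairC-injective : pairC x ≡ pairC z → x ≡ z
pairC-injective {x = x} {z = z} = cong proj₁ ∘ enc-injective {p = x , x} {q = z , z}

_⊑_ : Rails n → Rails n → Set
(l , h) ⊑ (l′ , h′) = l′ ≤ᶜ l × h ≤ᶜ h′

enc-mono : {p q : Rails n} → p ⊑ q → enc p ≤ᶜ enc q
enc-mono (l′≤l , h≤h′) = ++⁺ h≤h′ (comp-antitone l′≤l)

enc-mono⁻ : {p q : Rails n} → enc p ≤ᶜ enc q → p ⊑ q
enc-mono⁻ {p = _ , h} {q = _ , h′} le with ++⁻ h h′ le
... | h≤h′ , cl≤cl′ = comp-antitone⁻ cl≤cl′ , h≤h′

split-mono : ∀ {n} {s t : Config (n + n)} → s ≤ᶜ t → split {n} s ⊑ split t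
split-mono {n} {s} {t} s≤t =
  enc-mono⁻ {p = split s} {q = split t}
    (subst₂ _≤ᶜ_ (sym (enc-split {n} s)) (sym (enc-split {n} t)) s≤t)

bottom top : Rails n
bottom {n} = replicate n true , replicate n false
top    {n} = replicate n false , replicate n true

bottom-⊑ : {p : Rails n} → bottom ⊑ p
bottom-⊑ {p = l , h} = ≤ᶜ-all-true l , all-false-≤ᶜ h

⊑-top : {p : Rails n} → p ⊑ top
⊑-top {p = l , h} = all-false-≤ᶜ l , ≤ᶜ-all-true h

Gap : Rails n → Fin n → Set
Gap (l , h) i = lookup l i < lookup h i

gap? : (p : Rails n) (i : Fin n) → Dec (Gap p i)
gap? (l , h) i = lookup l i <? lookup h i

Ordered : Rails n → Set
Ordered (l , h) = l ≤ᶜ h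

ordered? : (p : Rails n) → Dec (Ordered p)
ordered? (l , h) = Pointwise.decidable _≤ᵇ?_ l h

Thin : Rails n → Set
Thin p = ∀ i k → Gap p i → Gap p k → i ≡ k

thin? : (p : Rails n) → Dec (Thin p)
thin? p = all? λ i → all? λ k → gap? p i →-dec gap? p k →-dec i ≟ᶠ k

-- The interval is a point or an edge of the cube.
Live : Rails n → Set
Live p = Ordered p × Thin p

live? : (p : Rails n) → Dec (Live p)
live? p = ordered? p ×-dec thin? p

⊑-ordered : {p q : Rails n} → p ⊑ q → Ordered p → Ordered q
⊑-ordered (l′≤l , h≤h′) l≤h = ≤ᶜ-trans l′≤l (≤ᶜ-trans l≤h h≤h′)

⊑-thin : {p q : Rails n} → p ⊑ q → Thin q → Thin p
⊑-thin (l′≤l , h≤h′) thin i k gᵢ gₖ = thin i k (widen i gᵢ) (widen k gₖ)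
  where
  widen = λ j gⱼ → <-transʳ (Pointwise.lookup l′≤l j) (<-transˡ gⱼ (Pointwise.lookup h≤h′ j))

live-agree : Live (l , h) → Gap (l , h) i → k ≢ i → lookup l k ≡ lookup h k
live-agree (l≤h , thin) gᵢ k≢i =
  Sum.[ id , (λ gₖ → ⊥-elim (k≢i (thin _ _ gₖ gᵢ))) ]′ (≤⇒≡⊎< (Pointwise.lookup l≤h _))

off-gap : l ≤ᶜ z → z ≤ᶜ h → ¬ Gap (l , h) k → lookup z k ≡ lookup l k × lookup z k ≡ lookup h k
off-gap {l = l} {z = z} {h = h} {k = k} l≤z z≤h no-gap
  with ≤⇒≡⊎< (Pointwise.lookup (≤ᶜ-trans l≤z z≤h) k)
... | inj₂ gₖ    = ⊥-elim (no-gap gₖ)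
... | inj₁ lₖ≡hₖ = zₖ≡lₖ , trans zₖ≡lₖ lₖ≡hₖ
  where
  zₖ≤lₖ = subst (lookup z k ≤ᵇ_) (sym lₖ≡hₖ) (Pointwise.lookup z≤h k)
  zₖ≡lₖ = ≤-antisym zₖ≤lₖ (Pointwise.lookup l≤z k)

squeeze : {y : Config n} → l ≤ᶜ z → z ≤ᶜ h →
          (∀ k → Gap (l , h) k → lookup z k ≡ lookup y k) → y ≡ l ⊎ y ≡ h → z ≡ y
squeeze {l = l} {z = z} {h = h} {y} l≤z z≤h on-gaps y-end = lookup-extensionality at
  where
  at : ∀ k → lookup z k ≡ lookup y k
  at k with gap? (l , h) k
  ... | yes gₖ    = on-gaps k gₖ
  ... | no no-gap = Sum.[ (λ y≡l → subst (agrees-with k) (sym y≡l) (proj₁ agrees))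
                        , (λ y≡h → subst (agrees-with k) (sym y≡h) (proj₂ agrees)) ]′ y-end
    where
    agrees = off-gap l≤z z≤h no-gap
    agrees-with = λ k w → lookup z k ≡ lookup w k

live-ends : Live (l , h) → l ≤ᶜ z → z ≤ᶜ h → z ≡ l ⊎ z ≡ h
live-ends {l = l} {h} {z} (_ , thin) l≤z z≤h with any? (gap? (l , h))
... | no gapless = inj₁ (squeeze l≤z z≤h (λ k gₖ → ⊥-elim (gapless (k , gₖ))) (inj₁ refl))
... | yes (i , gᵢ) = Sum.map (λ zᵢ≡lᵢ → squeeze l≤z z≤h (on-gaps {y = l} zᵢ≡lᵢ) (inj₁ refl))
                             (λ zᵢ≡hᵢ → squeeze l≤z z≤h (on-gaps {y = h} zᵢ≡hᵢ) (inj₂ refl))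
                             (<-covers gᵢ (lookup z i))
  where
  on-gaps : ∀ {y} → lookup z i ≡ lookup y i → ∀ k → Gap (l , h) k → lookup z k ≡ lookup y k
  on-gaps {y} zᵢ≡yᵢ k gₖ = subst (λ j → lookup z j ≡ lookup y j) (thin i k gᵢ gₖ) zᵢ≡yᵢ

data Regime (p : Rails n) : Set where
  inverted : ¬ Ordered p → Regime p
  wide     : Ordered p → ¬ Thin p → Regime p
  live     : Live p → Regime p

regime : (p : Rails n) → Regime p
regime p with ordered? p | thin? p
... | no ¬o | _     = inverted ¬o
... | yes o | no ¬t = wide o ¬t
... | yes o | yes t = live (o , t)

-- An arc of an asynchronous graph out of enc p, read on rails, when enc q is the image of enc p.
data StepToward (q p : Rails n) : Rails n → Set where
  upper : ∀ i → lookup (proj₂ q) i ≢ lookup (proj₂ p) i →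
          StepToward q p (proj₁ p , proj₂ p [ i ]≔ lookup (proj₂ q) i)
  lower : ∀ i → lookup (proj₁ q) i ≢ lookup (proj₁ p) i →
          StepToward q p (proj₁ p [ i ]≔ lookup (proj₁ q) i , proj₂ p)

toward-below : {p q p′ : Rails n} → q ⊑ p → StepToward q p p′ → p′ ⊑ p
toward-below (_ , H≤h) (upper i _) = ≤ᶜ-refl , []≔-≤ᶜ (Pointwise.lookup H≤h i)
toward-below (l≤L , _) (lower i _) = ≤ᶜ-[]≔ (Pointwise.lookup l≤L i) , ≤ᶜ-refl

toward-above : {p q p′ : Rails n} → p ⊑ q → StepToward q p p′ → p ⊑ p′
toward-above (_ , h≤H) (upper i _) = ≤ᶜ-refl , ≤ᶜ-[]≔ (Pointwise.lookup h≤H i)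
toward-above (L≤l , _) (lower i _) = []≔-≤ᶜ (Pointwise.lookup L≤l i) , ≤ᶜ-refl

lookup-enc-↑ˡ : (p : Rails n) (i : Fin n) → lookup (enc p) (i ↑ˡ n) ≡ lookup (proj₂ p) i
lookup-enc-↑ˡ (l , h) i = lookup-++ˡ h (comp l) i

lookup-enc-↑ʳ : (p : Rails n) (i : Fin n) → lookup (enc p) (n ↑ʳ i) ≡ not (lookup (proj₁ p) i)
lookup-enc-↑ʳ (l , h) i = trans (lookup-++ʳ h (comp l) i) (lookup-map i not l)

enc-update-↑ˡ : (p : Rails n) (i : Fin n) (v : Bool) →
                enc p [ i ↑ˡ n ]≔ v ≡ enc (proj₁ p , proj₂ p [ i ]≔ v)
enc-update-↑ˡ (l , h) i v = []≔-++-↑ˡ h (comp l) i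

enc-update-↑ʳ : (p : Rails n) (i : Fin n) (v : Bool) →
                enc p [ n ↑ʳ i ]≔ not v ≡ enc (proj₁ p [ i ]≔ v , proj₂ p)
enc-update-↑ʳ (l , h) i v = trans ([]≔-++-↑ʳ h (comp l) i) (cong (h ++_) (sym (map-[]≔ not l i)))

point : Config n → Rails n
point x = x , x

edge : Config n → Fin n → Rails n
edge x i = x [ i ]≔ false , x [ i ]≔ true

point-live : Live (point x)
point-live = ≤ᶜ-refl , λ _ _ gᵢ _ → ⊥-elim (<-irrefl refl gᵢ)

false-true⇒Gap : ∀ {p : Rails n} → lookup (proj₁ p) i ≡ false → lookup (proj₂ p) i ≡ true → Gap p i
false-true⇒Gap lᵢ≡false hᵢ≡true = subst₂ _<_ (sym lᵢ≡false) (sym hᵢ≡true) f<t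

edge-live : Live (edge x i)
edge-live {x = x} {i = i} = pointwise ordered , λ j k gⱼ gₖ → trans (only-gap gⱼ) (sym (only-gap gₖ))
  where
  ordered : ∀ k → lookup (x [ i ]≔ false) k ≤ᵇ lookup (x [ i ]≔ true) k
  ordered k with k ≟ᶠ i
  ... | yes refl = subst₂ _≤ᵇ_ (sym (lookup∘update k x false)) (sym (lookup∘update k x true)) f≤t
  ... | no k≢i   = ≤-reflexive ([]≔-agree-off {x = x} k≢i)

  only-gap : ∀ {k} → Gap (edge x i) k → k ≡ i
  only-gap {k} gₖ with k ≟ᶠ i
  ... | yes k≡i = k≡i
  ... | no k≢i  = ⊥-elim (<-irrefl ([]≔-agree-off {x = x} k≢i) gₖ)

edge-below : lookup x i ≡ false → (x , x [ i ]≔ true) ≡ edge x i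
edge-below {x = x} {i = i} xᵢ≡false = cong (_, x [ i ]≔ true) (sym ([]≔-self xᵢ≡false))

edge-above : lookup x i ≡ true → (x [ i ]≔ false , x) ≡ edge x i
edge-above {x = x} {i = i} xᵢ≡true = cong (x [ i ]≔ false ,_) (sym ([]≔-self xᵢ≡true))

¬live-upper-off-edge : k ≢ i → v ≢ lookup (x [ i ]≔ true) k →
                       ¬ Live (x [ i ]≔ false , (x [ i ]≔ true) [ k ]≔ v)
¬live-upper-off-edge {k = k} {i = i} {v = v} {x = x} k≢i moves live′ = moves (sym (begin
  lookup (x [ i ]≔ true) k             ≡⟨ []≔-agree-off {x = x} k≢i ⟩
  lookup (x [ i ]≔ false) k            ≡⟨ live-agree live′ gapᵢ k≢i ⟩
  lookup ((x [ i ]≔ true) [ k ]≔ v) k  ≡⟨ lookup∘update k (x [ i ]≔ true) v ⟩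
  v                                    ∎))
  where
  open ≡-Reasoning
  gapᵢ = false-true⇒Gap {p = x [ i ]≔ false , (x [ i ]≔ true) [ k ]≔ v}
                        (lookup∘update i x false)
                        (trans (lookup∘update′ (≢-sym k≢i) (x [ i ]≔ true) v) (lookup∘update i x true))

¬live-lower-off-edge : k ≢ i → v ≢ lookup (x [ i ]≔ false) k →
                       ¬ Live ((x [ i ]≔ false) [ k ]≔ v , x [ i ]≔ true)
¬live-lower-off-edge {k = k} {i = i} {v = v} {x = x} k≢i moves live′ = moves (begin
  v                                    ≡⟨ lookup∘update k (x [ i ]≔ false) v ⟨
  lookup ((x [ i ]≔ false) [ k ]≔ v) k ≡⟨ live-agree live′ gapᵢ k≢i ⟩
  lookup (x [ i ]≔ true) k             ≡⟨ []≔-agree-off {x = x} k≢i ⟩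
  lookup (x [ i ]≔ false) k            ∎)
  where
  open ≡-Reasoning
  gapᵢ = false-true⇒Gap {p = (x [ i ]≔ false) [ k ]≔ v , x [ i ]≔ true}
                        (trans (lookup∘update′ (≢-sym k≢i) (x [ i ]≔ false) v) (lookup∘update i x false))
                        (lookup∘update i x true)

module DualRail (f : BN n) where

  hull : Rails n → Rails n
  hull (l , h) = zipWith _∧_ (f l) (f h) , zipWith _∨_ (f l) (f h)

  rules : Rails n → Rails n
  rules p with regime p
  ... | inverted _ = bottom
  ... | wide _ _   = top
  ... | live _     = hull p

  f′ : BN (n + n)
  f′ s = enc (rules (split s))

  hull-mono : {p q : Rails n} → Live q → Ordered p → p ⊑ q → hull p ⊑ hull q
  hull-mono {p = l , h} {q = l′ , h′} live-q l≤h (l′≤l , h≤h′) = pointwise meets , pointwise joins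
    where
    values-at-ends : z ≡ l′ ⊎ z ≡ h′ → ∀ k →
                     lookup (f z) k ≡ lookup (f l′) k ⊎ lookup (f z) k ≡ lookup (f h′) k
    values-at-ends e k = Sum.map (cong (λ y → lookup (f y) k)) (cong (λ y → lookup (f y) k)) e

    l-end = values-at-ends (live-ends live-q l′≤l (≤ᶜ-trans l≤h h≤h′))
    h-end = values-at-ends (live-ends live-q (≤ᶜ-trans l′≤l l≤h) h≤h′)

    meets : ∀ k → lookup (zipWith _∧_ (f l′) (f h′)) k ≤ᵇ lookup (zipWith _∧_ (f l) (f h)) k
    meets k rewrite lookup-zipWith _∧_ k (f l′) (f h′) | lookup-zipWith _∧_ k (f l) (f h) =
      ∧-greatest (∧-≤-either (l-end k)) (∧-≤-either (h-end k))

    joins : ∀ k → lookup (zipWith _∨_ (f l) (f h)) k ≤ᵇ lookup (zipWith _∨_ (f l′) (f h′)) k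
    joins k rewrite lookup-zipWith _∨_ k (f l) (f h) | lookup-zipWith _∨_ k (f l′) (f h′) =
      ∨-least (∨-≥-either (l-end k)) (∨-≥-either (h-end k))

  rules-mono : {p q : Rails n} → p ⊑ q → rules p ⊑ rules q
  rules-mono {p = p} {q} p⊑q with regime p | regime q
  ... | inverted _   | _            = bottom-⊑
  ... | wide o _     | inverted ¬o′ = ⊥-elim (¬o′ (⊑-ordered p⊑q o))
  ... | live (o , _) | inverted ¬o′ = ⊥-elim (¬o′ (⊑-ordered p⊑q o))
  ... | _            | wide _ _     = ⊑-top
  ... | wide _ ¬t    | live (_ , t) = ⊥-elim (¬t (⊑-thin p⊑q t))
  ... | live (o , _) | live live-q  = hull-mono live-q o p⊑q

  f′-monotone : Monotone f′
  f′-monotone s t s≤t = enc-mono {p = rules (split s)} {q = rules (split t)}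
                          (rules-mono {p = split s} {q = split t} (split-mono s≤t))

  rules-live : {p : Rails n} → Live p → rules p ≡ hull p
  rules-live {p} live-p with regime p
  ... | inverted ¬o = ⊥-elim (¬o (proj₁ live-p))
  ... | wide _ ¬t   = ⊥-elim (¬t (proj₂ live-p))
  ... | live _      = refl

  rules-point : rules (point x) ≡ (f x , f x)
  rules-point {x} =
    trans (rules-live point-live) (cong₂ _,_ (zipWith-idem ∧-idem (f x)) (zipWith-idem ∨-idem (f x)))

  f′-enc : (p : Rails n) → f′ (enc p) ≡ enc (rules p)
  f′-enc p = cong (enc ∘ rules) (split-enc p)

  f′-pairC : f′ (pairC x) ≡ pairC (f x)
  f′-pairC {x} = trans (f′-enc (point x)) (cong enc rules-point)

  fixed-point⇔ : ∀ x → FixedPoint f x ⇔ FixedPoint f′ (pairC x)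
  fixed-point⇔ x = mk⇔ (λ fx≡x → trans f′-pairC (cong pairC fx≡x))
                       (λ fixed → pairC-injective (trans (sym f′-pairC) fixed))

  lookup-f′-enc-↑ˡ : (p : Rails n) (i : Fin n) → lookup (f′ (enc p)) (i ↑ˡ n) ≡ lookup (proj₂ (rules p)) i
  lookup-f′-enc-↑ˡ p i = trans (cong (λ s → lookup s (i ↑ˡ n)) (f′-enc p)) (lookup-enc-↑ˡ (rules p) i)

  lookup-f′-enc-↑ʳ : (p : Rails n) (i : Fin n) →
                     lookup (f′ (enc p)) (n ↑ʳ i) ≡ not (lookup (proj₁ (rules p)) i)
  lookup-f′-enc-↑ʳ p i = trans (cong (λ s → lookup s (n ↑ʳ i)) (f′-enc p)) (lookup-enc-↑ʳ (rules p) i)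

  arc⇒step : (p : Rails n) {t : Config (n + n)} → Arc f′ (enc p) t →
             ∃ λ p′ → StepToward (rules p) p p′ × t ≡ enc p′
  arc⇒step p (j , moves , refl) with summand {n} {n} j
  ... | inl i = _ , upper i (λ e → moves (trans value (trans e (sym (lookup-enc-↑ˡ p i))))) ,
                trans (cong (enc p [ i ↑ˡ n ]≔_) value) (enc-update-↑ˡ p i _)
    where value = lookup-f′-enc-↑ˡ p i
  ... | inr i = _ , lower i (λ e → moves (trans value (trans (cong not e) (sym (lookup-enc-↑ʳ p i))))) ,
                trans (cong (enc p [ n ↑ʳ i ]≔_) value) (enc-update-↑ʳ p i _)
    where value = lookup-f′-enc-↑ʳ p i

  step⇒arc : {p p′ : Rails n} → StepToward (rules p) p p′ → Arc f′ (enc p) (enc p′)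
  step⇒arc {p} (upper i H≢h) =
    i ↑ˡ n , (λ e → H≢h (trans (sym value) (trans e (lookup-enc-↑ˡ p i)))) ,
    sym (trans (cong (enc p [ i ↑ˡ n ]≔_) value) (enc-update-↑ˡ p i _))
    where value = lookup-f′-enc-↑ˡ p i
  step⇒arc {p} (lower i L≢l) =
    n ↑ʳ i , (λ e → L≢l (not-injective (trans (sym value) (trans e (lookup-enc-↑ʳ p i))))) ,
    sym (trans (cong (enc p [ n ↑ʳ i ]≔_) value) (enc-update-↑ʳ p i _))
    where value = lookup-f′-enc-↑ʳ p i

  -- Outside the live intervals f′ moves every coordinate the same way, so these states are absorbing.
  ¬live-step : {p p′ : Rails n} → ¬ Live p → StepToward (rules p) p p′ → ¬ Live p′
  ¬live-step {p} dead st with regime p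
  ... | inverted ¬o = λ live′ → ¬o (⊑-ordered (toward-below bottom-⊑ st) (proj₁ live′))
  ... | wide _ ¬t   = λ live′ → ¬t (⊑-thin (toward-above ⊑-top st) (proj₂ live′))
  ... | live live-p = ⊥-elim (dead live-p)

  ¬live-path : (p : Rails n) {q : Rails n} {t : Config (n + n)} →
               ¬ Live p → Path f′ (enc p) t ℓ → t ≡ enc q → ¬ Live q
  ¬live-path p dead here e = subst (¬_ ∘ Live) (enc-injective {p = p} e) dead
  ¬live-path p dead (step a rest) e with arc⇒step p a
  ... | p′ , st , refl = ¬live-path p′ (¬live-step dead st) rest e

  live-source : (p : Rails n) {t : Config (n + n)} {y : Config n} →
                Path f′ (enc p) t ℓ → t ≡ pairC y → Live p
  live-source p {y = y} path t≡ with live? p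
  ... | yes live-p = live-p
  ... | no dead    = ⊥-elim (¬live-path p {q = point y} dead path t≡ point-live)

  point-step : {p′ : Rails n} → StepToward (rules (point x)) (point x) p′ → Live p′ →
               ∃ λ i → lookup (f x) i ≢ lookup x i × p′ ≡ edge x i
  point-step {x} st = from-point (subst (λ q → StepToward q (point x) _) rules-point st)
    where
    from-point : {p′ : Rails n} → StepToward (f x , f x) (point x) p′ → Live p′ →
                 ∃ λ i → lookup (f x) i ≢ lookup x i × p′ ≡ edge x i
    from-point (upper i fᵢ≢xᵢ) (l≤h , _)
      with ≤∧≢⇒false-true (subst (lookup x i ≤ᵇ_) (lookup∘update i x _) (Pointwise.lookup l≤h i))
                          (≢-sym fᵢ≢xᵢ)
    ... | xᵢ≡false , fᵢ≡true =
      i , fᵢ≢xᵢ , trans (cong (λ w → x , x [ i ]≔ w) fᵢ≡true) (edge-below xᵢ≡false)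
    from-point (lower i fᵢ≢xᵢ) (l≤h , _)
      with ≤∧≢⇒false-true (subst (_≤ᵇ lookup x i) (lookup∘update i x _) (Pointwise.lookup l≤h i))
                          fᵢ≢xᵢ
    ... | fᵢ≡false , xᵢ≡true =
      i , fᵢ≢xᵢ , trans (cong (λ w → x [ i ]≔ w , x) fᵢ≡false) (edge-above xᵢ≡true)

  point→edge : lookup (f x) i ≢ lookup x i → StepToward (rules (point x)) (point x) (edge x i)
  point→edge {x} {i} fᵢ≢xᵢ =
    subst (λ q → StepToward q (point x) (edge x i)) (sym rules-point) (by-cases _ refl)
    where
    fᵢ≡not-xᵢ = ¬-not fᵢ≢xᵢ
    by-cases : ∀ b → lookup x i ≡ b → StepToward (f x , f x) (point x) (edge x i)
    by-cases false xᵢ≡false = subst (StepToward _ _)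
      (trans (cong (λ w → x , x [ i ]≔ w) (trans fᵢ≡not-xᵢ (cong not xᵢ≡false))) (edge-below xᵢ≡false))
      (upper i fᵢ≢xᵢ)
    by-cases true xᵢ≡true = subst (StepToward _ _)
      (trans (cong (λ w → x [ i ]≔ w , x) (trans fᵢ≡not-xᵢ (cong not xᵢ≡true))) (edge-above xᵢ≡true))
      (lower i fᵢ≢xᵢ)

  EdgeConstant : Config n → Fin n → Bool → Set
  EdgeConstant x i b = ∀ c → lookup (f (x [ i ]≔ c)) i ≡ b

  fᵢ-[]≔-self : lookup (f (x [ i ]≔ lookup x i)) i ≡ lookup (f x) i
  fᵢ-[]≔-self {x} {i} = cong (λ y → lookup (f y) i) ([]≔-lookup x i)

  EdgeConstant-at : EdgeConstant x i b → lookup (f x) i ≡ b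
  EdgeConstant-at constant = trans (sym fᵢ-[]≔-self) (constant _)

  NoNegativeLoop⇒≤ : NoNegativeLoop f → ∀ x i →
                     lookup (f (x [ i ]≔ false)) i ≤ᵇ lookup (f (x [ i ]≔ true)) i
  NoNegativeLoop⇒≤ nnl x i
    with lookup (f (x [ i ]≔ false)) i in e₀ | lookup (f (x [ i ]≔ true)) i in e₁
  ... | false | _     = ≤-minimum _
  ... | true  | true  = b≤b
  ... | true  | false = ⊥-elim (nnl i (x , e₁ , e₀))

  flip⇒EdgeConstant : NoNegativeLoop f → lookup (f x) i ≢ lookup x i →
                      EdgeConstant x i (lookup (f x) i)
  flip⇒EdgeConstant {x} {i} nnl flips c =
    trans (monotone-moves⇒constant (λ c → lookup (f (x [ i ]≔ c)) i) (NoNegativeLoop⇒≤ nnl x i)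
                                   (subst (_≢ lookup x i) (sym fᵢ-[]≔-self) flips) c)
          fᵢ-[]≔-self

  edge-step : {p′ : Rails n} → StepToward (rules (edge x i)) (edge x i) p′ → Live p′ →
              ∃ λ b → EdgeConstant x i b × p′ ≡ point (x [ i ]≔ b)
  edge-step {x} {i} st = from-edge (subst (λ q → StepToward q (edge x i) _) (rules-live edge-live) st)
    where
    x⁰ = x [ i ]≔ false
    x¹ = x [ i ]≔ true
    fᵢ⁰ = lookup (f x⁰) i
    fᵢ¹ = lookup (f x¹) i
    from-edge : {p′ : Rails n} → StepToward (hull (edge x i)) (edge x i) p′ → Live p′ →
                ∃ λ b → EdgeConstant x i b × p′ ≡ point (x [ i ]≔ b)
    from-edge (upper k moves) live′ with k ≟ᶠ i
    ... | no k≢i   = ⊥-elim (¬live-upper-off-edge k≢i moves live′)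
    ... | yes refl =
      false ,
      (λ { false → ∨-conicalˡ fᵢ⁰ fᵢ¹ fᵢ⁰∨fᵢ¹≡false ; true → ∨-conicalʳ fᵢ⁰ fᵢ¹ fᵢ⁰∨fᵢ¹≡false }) ,
      cong (x⁰ ,_) (trans ([]≔-idempotent x k) (cong (x [ k ]≔_) w≡false))
      where
      w≡false = trans (¬-not moves) (cong not (lookup∘update k x true))
      fᵢ⁰∨fᵢ¹≡false = trans (sym (lookup-zipWith _∨_ k (f x⁰) (f x¹))) w≡false
    from-edge (lower k moves) live′ with k ≟ᶠ i
    ... | no k≢i   = ⊥-elim (¬live-lower-off-edge k≢i moves live′)
    ... | yes refl =
      true ,
      (λ { false → ∧-conicalˡ fᵢ⁰ fᵢ¹ fᵢ⁰∧fᵢ¹≡true ; true → ∧-conicalʳ fᵢ⁰ fᵢ¹ fᵢ⁰∧fᵢ¹≡true }) ,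
      cong (_, x¹) (trans ([]≔-idempotent x k) (cong (x [ k ]≔_) w≡true))
      where
      w≡true = trans (¬-not moves) (cong not (lookup∘update k x false))
      fᵢ⁰∧fᵢ¹≡true = trans (sym (lookup-zipWith _∧_ k (f x⁰) (f x¹))) w≡true

  edge→point : EdgeConstant x i b → StepToward (rules (edge x i)) (edge x i) (point (x [ i ]≔ b))
  edge→point {x} {i} {b} constant =
    subst (λ q → StepToward q (edge x i) _) (sym (rules-live edge-live)) (collapse b constant)
    where
    f⁰ = f (x [ i ]≔ false)
    f¹ = f (x [ i ]≔ true)
    collapse : ∀ b → EdgeConstant x i b → StepToward (hull (edge x i)) (edge x i) (point (x [ i ]≔ b))
    collapse false constant =
      subst (StepToward _ _) (cong (x [ i ]≔ false ,_) collapsed) (upper i moves)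
      where
      w≡false = trans (lookup-zipWith _∨_ i f⁰ f¹) (cong₂ _∨_ (constant false) (constant true))
      moves = λ e → subst (λ w → w ≢ true) (sym w≡false) (λ ()) (trans e (lookup∘update i x true))
      collapsed = trans ([]≔-idempotent x i) (cong (x [ i ]≔_) w≡false)
    collapse true constant =
      subst (StepToward _ _) (cong (_, x [ i ]≔ true) collapsed) (lower i moves)
      where
      w≡true = trans (lookup-zipWith _∧_ i f⁰ f¹) (cong₂ _∧_ (constant false) (constant true))
      moves = λ e → subst (λ w → w ≢ false) (sym w≡true) (λ ()) (trans e (lookup∘update i x false))
      collapsed = trans ([]≔-idempotent x i) (cong (x [ i ]≔_) w≡true)

  path⇒rail-path : NoNegativeLoop f → {x y : Config n} →
                   Path f x y ℓ → Path f′ (pairC x) (pairC y) (2 * ℓ)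
  path⇒rail-path nnl here = here
  path⇒rail-path nnl (step {ℓ = ℓ} (i , flips , refl) rest) =
    subst (Path f′ _ _) (sym (*-suc 2 ℓ))
      (step (step⇒arc (point→edge flips))
        (step (step⇒arc (edge→point (flip⇒EdgeConstant nnl flips)))
          (path⇒rail-path nnl rest)))

  rail-path⇒path : ∀ ℓ {x y : Config n} {t : Config (n + n)} →
                   Path f′ (pairC x) t (2 * ℓ) → t ≡ pairC y → Path f x y ℓ
  rail-path⇒path zero {x} {y} here t≡ =
    subst (λ z → Path f x z 0) (pairC-injective {x = x} {z = y} t≡) here
  rail-path⇒path (suc ℓ) {x} {y} path t≡ with subst (Path f′ _ _) (*-suc 2 ℓ) path
  ... | step a₁ (step a₂ rest) with arc⇒step (point x) a₁
  ... | p₁ , st₁ , refl with arc⇒step p₁ a₂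
  ... | p₂ , st₂ , refl with point-step st₁ (live-source p₁ {y = y} (step a₂ rest) t≡)
  ... | i , flips , refl with edge-step st₂ (live-source p₂ {y = y} rest t≡)
  ... | b , constant , refl =
    step (i , flips , cong (x [ i ]≔_) (sym (EdgeConstant-at constant))) (rail-path⇒path ℓ rest t≡)

theorem5 : ∀ {n} (f : BN n) → NoNegativeLoop f →
    Σ (BN (n + n)) λ f′ → Monotone f′ ×
    ((∀ x → FixedPoint f x ⇔ FixedPoint f′ (pairC x)) ×
    (∀ x y (ℓ : ℕ) → Path f x y ℓ ⇔ Path f′ (pairC x) (pairC y) (2 * ℓ)))
theorem5 f nnl =
  f′ , f′-monotone , fixed-point⇔ ,
  λ x y ℓ → mk⇔ (path⇒rail-path nnl) (λ path → rail-path⇒path ℓ path refl)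
  where open DualRail f
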